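{- Let $n\ge 5$ and let $G$ be a maximal outerplanar graph of order $n$. Then $TCL(G)$ is maximal among all maximal outerplanar graphs of order $n$ if and only if $G$ has exactly two ears.
   Context: A maximal outerplanar graph of order $n$ is regarded as a drawing consisting of an $n$-cycle $\mathcal{C}$ together with a triangulation (by non-crossing edges between vertices of $\mathcal{C}$) of the bounded region determined by $\mathcal{C}$. Edges not in $\mathcal{C}$ are chords; the length of a chord is the length of a shortest path in $\mathcal{C}$ between its endpoints; $TCL(G)$ is the sum of the lengths of all chords. An ear is a chord of length $2$; each ear corresponds to a vertex of degree $2$ of the graph. -}

module Defs where

open import Data.Nat using (ℕ; zero; suc; _+_; _∸_; _≤_; _<_; _⊓_; _≟_)
open import Data.Product using (_×_; _,_; ∃; Σ-syntax)
open import Data.Sum using (_⊎_)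
open import Data.List using (List; map; filter; length)
open import Data.Nat.ListAction using (sum)
open import Data.List.Relation.Unary.All using (All)
open import Data.List.Relation.Unary.Unique.Propositional using (Unique)
open import Data.List.Membership.Propositional using (_∈_; _∉_)
open import Relation.Binary.PropositionalEquality using (_≡_)
open import Relation.Nullary using (¬_)

-- The n-cycle C has vertices 0,1,…,n-1 (in cyclic order) and edges
-- {i, i+1} and {n-1, 0}.  A chord candidate is a pair (i , j) with i < j.
Pair : Set
Pair = ℕ × ℕ

IsDiag : ℕ → Pair → Set
IsDiag n (i , j) = suc i < j × j < n × ¬ (i ≡ 0 × suc j ≡ n)

-- Two diagonals cross (in the convex drawing) iff their endpoints interleave.
Cross : Pair → Pair → Set
Cross (i , j) (k , l) = (i < k × k < j × j < l) ⊎ (k < i × i < l × l < j)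

-- Together with C this is a maximal
-- outerplanar graph of order n (drawn as in the paper); the chords are cs.
record Triangulation (n : ℕ) (cs : List Pair) : Set where
  field
    diagonals : All (IsDiag n) cs
    distinct  : Unique cs
    nonCross  : ∀ {c d} → c ∈ cs → d ∈ cs → ¬ Cross c d
    maximal   : ∀ d → IsDiag n d → d ∉ cs → ∃ λ c → c ∈ cs × Cross c d

-- Length of chord (i , j) with i < j: length of a shortest path in C.
chordLength : ℕ → Pair → ℕ
chordLength n (i , j) = (j ∸ i) ⊓ (n ∸ (j ∸ i))

TCL : ℕ → List Pair → ℕ
TCL n cs = sum (map (chordLength n) cs)

numEars : ℕ → List Pair → ℕ
numEars n cs = length (filter (λ c → chordLength n c ≟ 2) cs)

{-# OPTIONS --safe #-}
module Submission where

-- Every side (a , b) of the triangulation, a cycle edge or a chord with a < b, cuts off the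
-- triangulated sub-polygon a, a+1, …, b of span s = b − a. Compare the pair (total length,
-- number of ears) of its chords, (a , b) included, with the pair (fanSum s , minEars s) of the
-- fan from a. Cutting along the triangle on (a , b), induction on s shows that either the two
-- pairs are equal or the triangulation has strictly smaller length and strictly more ears (the
-- relation ≼): gluing two fans along a chord is again a fan if one of them is a single edge,
-- and otherwise it strictly loses length and gains an ear. The triangle on the cycle edge
-- {0, n−1} splits the whole polygon into two such regions whose fan pairs add up to
-- (TCL of the fan from 0 , 2), so TCL is maximal exactly when there are two ears.

open import Defs
open import Data.List using (List; []; _∷_; map; filter; length)
open import Data.List.Membership.Propositional using (_∈_; _∉_)
open import Data.List.Properties using (map-cong-local)
open import Data.List.Relation.Unary.All as All using ()
open import Data.List.Relation.Unary.AllPairs using ([]; _∷_)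
open import Data.List.Relation.Unary.Any using (here; there)
open import Data.List.Relation.Unary.Unique.Propositional using (Unique)
open import Data.Nat
open import Data.Nat.Induction using (<-wellFounded)
open import Data.Nat.ListAction using (sum)
open import Data.Nat.Properties
open import Algebra.Properties.CommutativeSemigroup +-commutativeSemigroup using (interchange; x∙yz≈xz∙y)
open import Data.Product using (_×_; _,_; proj₁; proj₂; ∃-syntax)
open import Data.Product.Properties using (≡-dec)
open import Data.Sum using (_⊎_; inj₁; inj₂; [_,_]′)
open import Function using (_∘_)
open import Function.Bundles using (_⇔_; mk⇔)
open import Induction.WellFounded using (Acc; acc)
open import Relation.Binary.Bundles using (Preorder)
open import Relation.Binary.Definitions using (DecidableEquality; tri<; tri≈; tri>)
open import Relation.Binary.PropositionalEquality
import Relation.Binary.Reasoning.Preorder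
open import Relation.Nullary using (Dec; yes; no; ¬_; contradiction)
open import Relation.Nullary.Decidable using (_×-dec_; _⊎-dec_)
open import Relation.Unary using (Decidable)

𝟙 : ∀ {p} {P : Set p} → Dec P → ℕ
𝟙 (yes _) = 1
𝟙 (no _)  = 0

𝟙-yes : ∀ {p} {P : Set p} → P → (P? : Dec P) → 𝟙 P? ≡ 1
𝟙-yes _ (yes _) = refl
𝟙-yes p (no ¬p) = contradiction p ¬p

𝟙-no : ∀ {p} {P : Set p} → ¬ P → (P? : Dec P) → 𝟙 P? ≡ 0
𝟙-no ¬p (yes p) = contradiction p ¬p
𝟙-no _  (no _)  = refl

𝟙-partition : ∀ {p} {P Q R S : Set p} (P? : Dec P) (Q? : Dec Q) (R? : Dec R) (S? : Dec S) →
  (P → Q ⊎ R ⊎ S) → (Q ⊎ R ⊎ S → P) → (Q → ¬ R) → (Q → ¬ S) → (R → ¬ S) →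
  𝟙 P? ≡ 𝟙 Q? + 𝟙 R? + 𝟙 S?
𝟙-partition (no ¬p) Q? R? S? _ from _ _ _
  rewrite 𝟙-no (¬p ∘ from ∘ inj₁) Q?
        | 𝟙-no (¬p ∘ from ∘ inj₂ ∘ inj₁) R?
        | 𝟙-no (¬p ∘ from ∘ inj₂ ∘ inj₂) S? = refl
𝟙-partition (yes _) (yes q) R? S? _ _ q⇒¬r q⇒¬s _
  rewrite 𝟙-no (q⇒¬r q) R? | 𝟙-no (q⇒¬s q) S? = refl
𝟙-partition (yes _) (no _) (yes r) S? _ _ _ _ r⇒¬s
  rewrite 𝟙-no (r⇒¬s r) S? = refl
𝟙-partition (yes _) (no _) (no _) (yes _) _ _ _ _ _ = refl
𝟙-partition (yes p) (no ¬q) (no ¬r) (no ¬s) to _ _ _ _ with to p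
... | inj₁ q        = contradiction q ¬q
... | inj₂ (inj₁ r) = contradiction r ¬r
... | inj₂ (inj₂ s) = contradiction s ¬s

module _ {a} {A : Set a} where

  sum-map-cong : ∀ {f g : A → ℕ} {xs} → (∀ {x} → x ∈ xs → f x ≡ g x) →
    sum (map f xs) ≡ sum (map g xs)
  sum-map-cong f≗g = cong sum (map-cong-local (All.tabulate f≗g))

  sum-map-zero : ∀ {f : A → ℕ} {xs} → (∀ {x} → x ∈ xs → f x ≡ 0) → sum (map f xs) ≡ 0
  sum-map-zero {xs = []}     f≡0 = refl
  sum-map-zero {xs = x ∷ xs} f≡0 = cong₂ _+_ (f≡0 (here refl)) (sum-map-zero (f≡0 ∘ there))

  sum-map-+ : ∀ (f g : A → ℕ) xs →
    sum (map (λ x → f x + g x) xs) ≡ sum (map f xs) + sum (map g xs)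
  sum-map-+ f g []       = refl
  sum-map-+ f g (x ∷ xs) = trans (cong (f x + g x +_) (sum-map-+ f g xs))
                                 (interchange (f x) (g x) (sum (map f xs)) (sum (map g xs)))

  length-filter≡sum-𝟙 : ∀ {p} {P : A → Set p} (P? : Decidable P) xs →
    length (filter P? xs) ≡ sum (map (𝟙 ∘ P?) xs)
  length-filter≡sum-𝟙 P? []       = refl
  length-filter≡sum-𝟙 P? (x ∷ xs) with P? x
  ... | yes _ = cong suc (length-filter≡sum-𝟙 P? xs)
  ... | no _  = length-filter≡sum-𝟙 P? xs

  module _ (_≟_ : DecidableEquality A) (w : A → ℕ) where

    sum-𝟙≡-∉ : ∀ {y xs} → y ∉ xs → sum (map (λ x → 𝟙 (x ≟ y) * w x) xs) ≡ 0
    sum-𝟙≡-∉ {y} y∉xs = sum-map-zero λ {x} x∈xs → cong (_* w x) (𝟙-no (λ { refl → y∉xs x∈xs }) (x ≟ y))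

    sum-𝟙≡-∈ : ∀ {y xs} → Unique xs → y ∈ xs → sum (map (λ x → 𝟙 (x ≟ y) * w x) xs) ≡ w y
    sum-𝟙≡-∈ {y} (y∉ys ∷ _) (here refl)
      rewrite 𝟙-yes refl (y ≟ y) | sum-𝟙≡-∉ (λ y∈ys → All.lookup y∉ys y∈ys refl) =
      trans (+-identityʳ (w y + 0)) (+-identityʳ (w y))
    sum-𝟙≡-∈ {y} {x ∷ _} (x∉xs ∷ xs-unique) (there y∈xs)
      rewrite 𝟙-no (λ { refl → All.lookup x∉xs y∈xs refl }) (x ≟ y) = sum-𝟙≡-∈ xs-unique y∈xs

greatest-below : ∀ {p} {P : ℕ → Set p} → Decidable P → ∀ {x y} → P x → x < y →
  ∃[ k ] x ≤ k × k < y × P k × (∀ {j} → k < j → j < y → ¬ P j)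
greatest-below P? {y = suc y} px x<1+y with P? y
... | yes py = y , ≤-pred x<1+y , ≤-refl , py , λ y<j j<1+y → contradiction (≤-pred j<1+y) (<⇒≱ y<j)
... | no ¬py with m≤n⇒m<n∨m≡n (≤-pred x<1+y)
...   | inj₂ refl = contradiction px ¬py
...   | inj₁ x<y with greatest-below P? px x<y
...     | k , x≤k , k<y , pk , above = k , x≤k , m≤n⇒m≤1+n k<y , pk , λ k<j j<1+y →
            [ above k<j , (λ { refl → ¬py }) ]′ (m≤n⇒m<n∨m≡n (≤-pred j<1+y))

∸-split : ∀ {a k b} → a ≤ k → k ≤ b → (k ∸ a) + (b ∸ k) ≡ b ∸ a
∸-split {a} {k} {b} a≤k k≤b = trans (sym (+-∸-comm (b ∸ k) a≤k)) (cong (_∸ a) (m+[n∸m]≡n k≤b))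

_≟ₚ_ : DecidableEquality Pair
_≟ₚ_ = ≡-dec _≟_ _≟_

span : Pair → ℕ
span (i , j) = j ∸ i

_≼_ : ℕ × ℕ → ℕ × ℕ → Set
(V , E) ≼ (V′ , E′) = (V ≡ V′ × E ≡ E′) ⊎ (V < V′ × E′ < E)

≼-reflexive : ∀ {p q} → p ≡ q → p ≼ q
≼-reflexive refl = inj₁ (refl , refl)

≼-trans : ∀ {p q r} → p ≼ q → q ≼ r → p ≼ r
≼-trans (inj₁ (refl , refl)) q≼r                    = q≼r
≼-trans (inj₂ p≺q)           (inj₁ (refl , refl))   = inj₂ p≺q
≼-trans (inj₂ (V<V′ , E′<E)) (inj₂ (V′<V″ , E″<E′)) = inj₂ (<-trans V<V′ V′<V″ , <-trans E″<E′ E′<E)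

≼-preorder : Preorder _ _ _
≼-preorder = record
  { isPreorder = record { isEquivalence = isEquivalence ; reflexive = ≼-reflexive ; trans = ≼-trans } }

module ≼-Reasoning = Relation.Binary.Reasoning.Preorder ≼-preorder

≼⇒≤ : ∀ {V E V′ E′} → (V , E) ≼ (V′ , E′) → V ≤ V′ × E′ ≤ E
≼⇒≤ (inj₁ (refl , refl))   = ≤-refl , ≤-refl
≼⇒≤ (inj₂ (V<V′ , E′<E)) = <⇒≤ V<V′ , <⇒≤ E′<E

≼-+ : ∀ {V₁ E₁ V₁′ E₁′ V₂ E₂ V₂′ E₂′} → (V₁ , E₁) ≼ (V₁′ , E₁′) → (V₂ , E₂) ≼ (V₂′ , E₂′) →
  (V₁ + V₂ , E₁ + E₂) ≼ (V₁′ + V₂′ , E₁′ + E₂′)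
≼-+ (inj₁ (refl , refl)) (inj₁ (refl , refl))         = inj₁ (refl , refl)
≼-+ (inj₁ (refl , refl)) (inj₂ (V₂<V₂′ , E₂′<E₂)) = inj₂ (+-monoʳ-< _ V₂<V₂′ , +-monoʳ-< _ E₂′<E₂)
≼-+ (inj₂ (V₁<V₁′ , E₁′<E₁)) p₂ =
  let V₂≤V₂′ , E₂′≤E₂ = ≼⇒≤ p₂ in inj₂ (+-mono-<-≤ V₁<V₁′ V₂≤V₂′ , +-mono-<-≤ E₁′<E₁ E₂′≤E₂)

fan : ℕ → List Pair
fan (suc (suc k)) = (0 , suc (suc k)) ∷ fan (suc k)
fan _             = []

∈-fan⁻ : ∀ {k i l} → (i , l) ∈ fan k → i ≡ 0 × 2 ≤ l × l ≤ k
∈-fan⁻ {suc (suc k)} (here refl)    = refl , s≤s (s≤s z≤n) , ≤-refl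
∈-fan⁻ {suc (suc k)} (there il∈fan) =
  let i≡0 , 2≤l , l≤1+k = ∈-fan⁻ il∈fan in i≡0 , 2≤l , m≤n⇒m≤1+n l≤1+k

∈-fan⁺ : ∀ {k l} → 2 ≤ l → l ≤ k → (0 , l) ∈ fan k
∈-fan⁺ {0}           (s≤s (s≤s _)) ()
∈-fan⁺ {1}           (s≤s (s≤s _)) (s≤s ())
∈-fan⁺ {suc (suc k)} 2≤l l≤2+k =
  [ (λ l<2+k → there (∈-fan⁺ 2≤l (≤-pred l<2+k)))
  , (λ l≡2+k → subst (λ l → (0 , l) ∈ fan (2 + k)) (sym l≡2+k) (here refl))
  ]′ (m≤n⇒m<n∨m≡n l≤2+k)

fan-unique : ∀ k → Unique (fan k)
fan-unique 0             = []
fan-unique 1             = []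
fan-unique (suc (suc k)) =
  All.tabulate (λ c∈fan → λ { refl → 1+n≰n (proj₂ (proj₂ (∈-fan⁻ c∈fan))) }) ∷ fan-unique (suc k)

module Polygon (m : ℕ) where

  -- N = n − 2 is the largest span of a diagonal of the n-gon.
  N : ℕ
  N = 3 + m

  n : ℕ
  n = 2 + N

  len : ℕ → ℕ
  len s = s ⊓ (n ∸ s)

  -- The fan from a in a region of span s has the chords (a , a + t), 2 ≤ t ≤ s.
  fanSum : ℕ → ℕ
  fanSum 0 = 0
  fanSum 1 = 0
  fanSum (suc (suc s)) = fanSum (suc s) + len (suc (suc s))

  -- A region of span s ≥ 2 contains an ear; when s = N its bounding chord is an ear as well.
  minEars : ℕ → ℕ
  minEars s = 𝟙 (2 ≤? s) + 𝟙 (s ≟ N)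

  ear : ℕ → ℕ
  ear s = 𝟙 (len s ≟ 2)

  len≤ : ∀ s → len s ≤ s
  len≤ s = m⊓n≤m s (n ∸ s)

  ≤len : ∀ {t s} → t ≤ s → t + s ≤ n → t ≤ len s
  ≤len {t} t≤s t+s≤n = ⊓-glb t≤s (m+n≤o⇒m≤o∸n t t+s≤n)

  len-complement : ∀ s t → s + t ≡ n → len s ≡ len t
  len-complement s t s+t≡n = begin
    s ⊓ (n ∸ s)     ≡⟨ cong (λ k → s ⊓ (k ∸ s)) (sym s+t≡n) ⟩
    s ⊓ (s + t ∸ s) ≡⟨ cong (s ⊓_) (m+n∸m≡n s t) ⟩
    s ⊓ t           ≡⟨ ⊓-comm s t ⟩
    t ⊓ s           ≡⟨ cong (t ⊓_) (m+n∸n≡m s t) ⟨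
    t ⊓ (s + t ∸ t) ≡⟨ cong (λ k → t ⊓ (k ∸ t)) s+t≡n ⟩
    t ⊓ (n ∸ t)     ∎
    where open ≡-Reasoning

  fanSum-suc : ∀ {s} → 1 ≤ s → fanSum (suc s) ≡ fanSum s + len (suc s)
  fanSum-suc {suc s} _ = refl

  fanSum-shift : ∀ {u w} → suc w ≤ u → u + suc (suc w) ≤ N →
    fanSum u + fanSum (suc (suc w)) + len (u + suc (suc w))
      ≤ fanSum (suc u) + fanSum (suc w) + len (suc u + suc w)
  fanSum-shift {u} {w} w<u bound = begin
    fanSum u + (fanSum (suc w) + len (suc (suc w))) + len (u + suc (suc w))
      ≤⟨ +-monoˡ-≤ _ (+-monoʳ-≤ (fanSum u) (+-monoʳ-≤ (fanSum (suc w)) len-2+w≤len-1+u)) ⟩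
    fanSum u + (fanSum (suc w) + len (suc u)) + len (u + suc (suc w))
      ≡⟨ cong₂ _+_ (x∙yz≈xz∙y (fanSum u) (fanSum (suc w)) (len (suc u))) (cong len (+-suc u (suc w))) ⟩
    fanSum u + len (suc u) + fanSum (suc w) + len (suc u + suc w)
      ≡⟨ cong (λ x → x + fanSum (suc w) + len (suc u + suc w)) (fanSum-suc (≤-trans (s≤s z≤n) w<u)) ⟨
    fanSum (suc u) + fanSum (suc w) + len (suc u + suc w) ∎
    where
    open ≤-Reasoning
    len-2+w≤len-1+u : len (suc (suc w)) ≤ len (suc u)
    len-2+w≤len-1+u = ≤-trans (len≤ (suc (suc w))) (≤len (s≤s w<u) (s≤s (s≤s (begin
      w + suc u       ≡⟨ trans (+-comm w (suc u)) (sym (+-suc u w)) ⟩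
      u + suc w       ≤⟨ +-monoʳ-≤ u (n≤1+n (suc w)) ⟩
      u + suc (suc w) ≤⟨ bound ⟩
      N               ∎))))

  fanSum-superadditive-ordered : ∀ {u v} → 2 ≤ v → v ≤ u → u + v ≤ N →
    fanSum u + fanSum v + len (u + v) < fanSum (u + v)
  fanSum-superadditive-ordered {u} {2} _ 2≤u bound = begin-strict
    fanSum u + 2 + len (u + 2)           <⟨ +-monoˡ-< (len (u + 2)) (+-monoʳ-< (fanSum u) 2<len-1+u) ⟩
    fanSum u + len (suc u) + len (u + 2) ≡⟨ cong₂ _+_ (fanSum-suc (≤-trans (s≤s z≤n) 2≤u)) (cong len (sym u+2≡2+u)) ⟨
    fanSum (suc u) + len (suc (suc u))   ≡⟨ cong fanSum u+2≡2+u ⟨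
    fanSum (u + 2)                       ∎
    where
    open ≤-Reasoning
    u+2≡2+u : u + 2 ≡ 2 + u
    u+2≡2+u = +-comm u 2
    2<len-1+u : 2 < len (suc u)
    2<len-1+u = ≤len (s≤s 2≤u) (s≤s (s≤s (subst (_≤ N) u+2≡2+u bound)))
  fanSum-superadditive-ordered {u} {suc (suc (suc w))} _ 3+w≤u bound = begin-strict
    fanSum u + fanSum (3 + w) + len (u + (3 + w))
      ≤⟨ fanSum-shift (≤-trans (n≤1+n _) 3+w≤u) bound ⟩
    fanSum (suc u) + fanSum (2 + w) + len (suc u + (2 + w))
      <⟨ fanSum-superadditive-ordered (s≤s (s≤s z≤n)) (≤-trans (n≤1+n _) (m≤n⇒m≤1+n 3+w≤u))
           (subst (_≤ N) u+3+w≡1+u+2+w bound) ⟩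
    fanSum (suc u + (2 + w))
      ≡⟨ cong fanSum u+3+w≡1+u+2+w ⟨
    fanSum (u + (3 + w)) ∎
    where
    open ≤-Reasoning
    u+3+w≡1+u+2+w : u + (3 + w) ≡ suc u + (2 + w)
    u+3+w≡1+u+2+w = +-suc u (2 + w)
  fanSum-superadditive-ordered {v = 1} (s≤s ()) _ _

  fanSum-superadditive : ∀ {u v} → 2 ≤ u → 2 ≤ v → u + v ≤ N →
    fanSum u + fanSum v + len (u + v) < fanSum (u + v)
  fanSum-superadditive {u} {v} 2≤u 2≤v bound with ≤-total v u
  ... | inj₁ v≤u = fanSum-superadditive-ordered 2≤v v≤u bound
  ... | inj₂ u≤v =
    subst₂ _<_ (cong₂ _+_ (+-comm (fanSum v) (fanSum u)) (cong len (+-comm v u))) (cong fanSum (+-comm v u))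
      (fanSum-superadditive-ordered 2≤u u≤v (subst (_≤ N) (+-comm u v) bound))

  fanSum-complement : ∀ {u v} → 1 ≤ u → 1 ≤ v → u + v ≡ suc N → fanSum u + fanSum v ≡ fanSum N
  fanSum-complement {1} _ _ 1+v≡1+N = cong fanSum (suc-injective 1+v≡1+N)
  fanSum-complement {suc (suc u)} {suc v} _ _ 2+u+1+v≡1+N = begin
    fanSum (suc u) + len (2 + u) + fanSum (suc v)
      ≡⟨ cong (λ x → fanSum (suc u) + x + fanSum (suc v)) (len-complement (2 + u) (2 + v) (cong suc 1+u+2+v≡1+N)) ⟩
    fanSum (suc u) + len (2 + v) + fanSum (suc v)
      ≡⟨ x∙yz≈xz∙y (fanSum (suc u)) (fanSum (suc v)) (len (2 + v)) ⟨
    fanSum (suc u) + fanSum (2 + v)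
      ≡⟨ fanSum-complement (s≤s z≤n) (s≤s z≤n) 1+u+2+v≡1+N ⟩
    fanSum N ∎
    where
    open ≡-Reasoning
    1+u+2+v≡1+N : suc u + suc (suc v) ≡ suc N
    1+u+2+v≡1+N = trans (cong suc (+-suc u (suc v))) 2+u+1+v≡1+N

  minEars-N : minEars N ≡ 2
  minEars-N = cong (1 +_) (𝟙-yes refl (N ≟ N))

  minEars-between : ∀ {s} → 2 ≤ s → s < N → minEars s ≡ 1
  minEars-between {s} 2≤s s<N = cong₂ _+_ (𝟙-yes 2≤s (2 ≤? s)) (𝟙-no (<⇒≢ s<N) (s ≟ N))

  ear-N : ear N ≡ 1
  ear-N = 𝟙-yes (cong (N ⊓_) (m+n∸n≡m 2 N)) (len N ≟ 2)

  ear-between : ∀ {s} → 3 ≤ s → s < N → ear s ≡ 0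
  ear-between {s} 3≤s s<N = 𝟙-no (λ len≡2 → <⇒≢ (≤len 3≤s (s≤s (s≤s s<N))) (sym len≡2)) (len s ≟ 2)

  minEars-suc : ∀ {s} → 1 ≤ s → suc s ≤ N → minEars s + ear (suc s) ≡ minEars (suc s)
  minEars-suc {1} _ _ = sym (minEars-between ≤-refl (s≤s (s≤s (s≤s z≤n))))
  minEars-suc {suc (suc s)} _ 3+s≤N with m≤n⇒m<n∨m≡n 3+s≤N
  ... | inj₁ 3+s<N = begin
    minEars (2 + s) + ear (3 + s)
      ≡⟨ cong₂ _+_ (minEars-between (s≤s (s≤s z≤n)) (<-trans (n<1+n _) 3+s<N))
                   (ear-between (s≤s (s≤s (s≤s z≤n))) 3+s<N) ⟩
    1
      ≡⟨ minEars-between (s≤s (s≤s z≤n)) 3+s<N ⟨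
    minEars (3 + s) ∎
    where open ≡-Reasoning
  ... | inj₂ refl = begin
    minEars (2 + m) + ear N ≡⟨ cong₂ _+_ (minEars-between (s≤s (s≤s z≤n)) (n<1+n _)) ear-N ⟩
    2                       ≡⟨ minEars-N ⟨
    minEars N               ∎
    where open ≡-Reasoning

  minEars≤1+ear : ∀ {s} → 3 ≤ s → s ≤ N → minEars s ≤ 1 + ear s
  minEars≤1+ear {s} 3≤s s≤N with m≤n⇒m<n∨m≡n s≤N
  ... | inj₁ s<N  = ≤-trans (≤-reflexive (minEars-between (≤-trans (n≤1+n 2) 3≤s) s<N)) (m≤m+n 1 (ear s))
  ... | inj₂ refl = ≤-reflexive (trans minEars-N (cong suc (sym ear-N)))

  minEars-superadditive : ∀ {u v} → 2 ≤ u → 2 ≤ v → u + v ≤ N →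
    minEars (u + v) < minEars u + minEars v + ear (u + v)
  minEars-superadditive {u} {v} 2≤u 2≤v bound = begin-strict
    minEars (u + v)                     ≤⟨ minEars≤1+ear (≤-trans (s≤s 2≤u) (m<m+n u 1≤v)) bound ⟩
    1 + ear (u + v)                     <⟨ n<1+n _ ⟩
    2 + ear (u + v)                     ≡⟨ cong (_+ ear (u + v)) (cong₂ _+_ (minEars-between 2≤u u<N)
                                                                          (minEars-between 2≤v v<N)) ⟨
    minEars u + minEars v + ear (u + v) ∎
    where
    open ≤-Reasoning
    1≤v : 1 ≤ v
    1≤v = ≤-trans (s≤s z≤n) 2≤v
    u<N : u < N
    u<N = <-≤-trans (m<m+n u 1≤v) bound
    v<N : v < N
    v<N = <-≤-trans (m<n+m v (≤-trans (s≤s z≤n) 2≤u)) bound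

  <N-of-complement : ∀ {u v} → 2 ≤ v → u + v ≡ suc N → u < N
  <N-of-complement {u} {v} 2≤v u+v≡1+N = ≤-pred (begin
    suc (suc u) ≡⟨ +-comm 2 u ⟩
    u + 2       ≤⟨ +-monoʳ-≤ u 2≤v ⟩
    u + v       ≡⟨ u+v≡1+N ⟩
    suc N       ∎)
    where open ≤-Reasoning

  minEars-complement : ∀ {u v} → 1 ≤ u → 1 ≤ v → u + v ≡ suc N → minEars u + minEars v ≡ 2
  minEars-complement {1} _ _ refl = minEars-N
  minEars-complement {u@(suc (suc _))} {1} _ _ u+1≡1+N = begin
    minEars u + 0 ≡⟨ +-identityʳ (minEars u) ⟩
    minEars u     ≡⟨ cong minEars (suc-injective (trans (+-comm 1 u) u+1≡1+N)) ⟩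
    minEars N     ≡⟨ minEars-N ⟩
    2             ∎
    where open ≡-Reasoning
  minEars-complement {u@(suc (suc _))} {v@(suc (suc _))} _ _ u+v≡1+N =
    cong₂ _+_ (minEars-between (s≤s (s≤s z≤n)) (<N-of-complement (s≤s (s≤s z≤n)) u+v≡1+N))
              (minEars-between (s≤s (s≤s z≤n)) (<N-of-complement (s≤s (s≤s z≤n)) (trans (+-comm v u) u+v≡1+N)))

  fan-extend : ∀ {s} → 1 ≤ s → suc s ≤ N →
    (fanSum s + len (suc s) , minEars s + ear (suc s)) ≡ (fanSum (suc s) , minEars (suc s))
  fan-extend 1≤s bound = cong₂ _,_ (sym (fanSum-suc 1≤s)) (minEars-suc 1≤s bound)

  fan-glue : ∀ {u v} → 1 ≤ u → 1 ≤ v → u + v ≤ N →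
    (fanSum u + fanSum v + len (u + v) , minEars u + minEars v + ear (u + v)) ≼ (fanSum (u + v) , minEars (u + v))
  fan-glue {1} _ 1≤v bound = ≼-reflexive (fan-extend 1≤v bound)
  fan-glue {u@(suc (suc _))} {1} 1≤u _ bound = ≼-reflexive (begin
    (fanSum u + 0 + len (u + 1) , minEars u + 0 + ear (u + 1))
      ≡⟨ cong₂ (λ x y → x + len (u + 1) , y + ear (u + 1)) (+-identityʳ (fanSum u)) (+-identityʳ (minEars u)) ⟩
    (fanSum u + len (u + 1) , minEars u + ear (u + 1))
      ≡⟨ cong (λ s → fanSum u + len s , minEars u + ear s) (+-comm u 1) ⟩
    (fanSum u + len (suc u) , minEars u + ear (suc u))
      ≡⟨ fan-extend 1≤u (subst (_≤ N) (+-comm u 1) bound) ⟩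
    (fanSum (suc u) , minEars (suc u))
      ≡⟨ cong (λ s → fanSum s , minEars s) (+-comm 1 u) ⟩
    (fanSum (u + 1) , minEars (u + 1)) ∎)
    where open ≡-Reasoning
  fan-glue {suc (suc _)} {suc (suc _)} _ _ bound =
    inj₂ ( fanSum-superadditive (s≤s (s≤s z≤n)) (s≤s (s≤s z≤n)) bound
         , minEars-superadditive (s≤s (s≤s z≤n)) (s≤s (s≤s z≤n)) bound)

  fan-complement : ∀ {u v} → 1 ≤ u → 1 ≤ v → u + v ≡ suc N →
    (fanSum u + fanSum v , minEars u + minEars v) ≡ (fanSum N , 2)
  fan-complement 1≤u 1≤v u+v≡1+N =
    cong₂ _,_ (fanSum-complement 1≤u 1≤v u+v≡1+N) (minEars-complement 1≤u 1≤v u+v≡1+N)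

  span≤N : ∀ {c} → IsDiag n c → span c ≤ N
  span≤N {zero , j} (_ , j<n , not-0-n-1) with m≤n⇒m<n∨m≡n (≤-pred j<n)
  ... | inj₁ j<1+N = ≤-pred j<1+N
  ... | inj₂ refl  = contradiction (refl , refl) not-0-n-1
  span≤N {suc i , zero}  _             = z≤n
  span≤N {suc i , suc j} (_ , j<n , _) = ≤-trans (m∸n≤m j i) (≤-pred (≤-pred j<n))

  module Triangulated {cs : List Pair} (T : Triangulation n cs) where
    open Triangulation T
    open import Data.List.Membership.DecPropositional _≟ₚ_ using (_∈?_)

    Edge : ℕ → ℕ → Set
    Edge a b = b ≡ suc a ⊎ (a , b) ∈ cs

    edge? : ∀ a b → Dec (Edge a b)
    edge? a b = (b ≟ suc a) ⊎-dec ((a , b) ∈? cs)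

    Uncrossed : ℕ → ℕ → Set
    Uncrossed a b = ∀ {c} → c ∈ cs → ¬ Cross c (a , b)

    edge-uncrossed : ∀ {a b} → Edge a b → Uncrossed a b
    edge-uncrossed (inj₁ refl) _ (inj₁ (_ , a<j , j<1+a)) = <⇒≱ a<j (≤-pred j<1+a)
    edge-uncrossed (inj₁ refl) _ (inj₂ (a<i , i<1+a , _)) = <⇒≱ a<i (≤-pred i<1+a)
    edge-uncrossed (inj₂ ab∈cs) c∈cs = nonCross c∈cs ab∈cs

    record Triangle (a b : ℕ) : Set where
      field
        apex   : ℕ
        a<apex : a < apex
        apex<b : apex < b
        left   : Edge a apex
        right  : Edge apex b

    -- The apex is the farthest neighbour k < b of a; maximality of the triangulation then
    -- forces (k , b) to be an edge.
    triangle : ∀ {a b} → suc a < b → b < n → Uncrossed a b → Triangle a b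
    triangle {a} {b} 1+a<b b<n uncrossed with greatest-below (edge? a) (inj₁ refl) 1+a<b
    ... | k , a<k , k<b , left , above =
      record { apex = k ; a<apex = a<k ; apex<b = k<b ; left = left ; right = right }
      where
      crossing-impossible : ∀ {c} → c ∈ cs → ¬ Cross c (k , b)
      crossing-impossible {p , q} pq∈cs (inj₂ (k<p , p<b , b<q)) =
        uncrossed pq∈cs (inj₂ (<-trans a<k k<p , p<b , b<q))
      crossing-impossible {p , q} pq∈cs (inj₁ (p<k , k<q , q<b)) with <-cmp p a
      ... | tri< p<a _ _  = uncrossed pq∈cs (inj₁ (p<a , <-trans a<k k<q , q<b))
      ... | tri≈ _ refl _ = above k<q q<b (inj₂ pq∈cs)
      ... | tri> _ _ a<p  = edge-uncrossed left pq∈cs (inj₂ (a<p , p<k , k<q))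
      right : Edge k b
      right with edge? k b
      ... | yes kb = kb
      ... | no ¬kb =
        let c , c∈cs , cross = maximal (k , b) diagonal (¬kb ∘ inj₂) in contradiction cross (crossing-impossible c∈cs)
        where
        diagonal : IsDiag n (k , b)
        diagonal = ≤∧≢⇒< k<b (¬kb ∘ inj₁ ∘ sym) , b<n , λ { (refl , _) → <⇒≱ a<k z≤n }

    inside : ℕ → ℕ → Pair → ℕ
    inside a b (i , j) = 𝟙 (a ≤? i ×-dec j ≤? b)

    regionSum : (ℕ → ℕ) → ℕ → ℕ → ℕ
    regionSum f a b = sum (map (λ c → inside a b c * f (span c)) cs)

    module _ {a b} (t : Triangle a b) where
      open Triangle t renaming (apex to k)

      chord-position : ∀ {i j} → (i , j) ∈ cs → a ≤ i × j ≤ b →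
        (a ≤ i × j ≤ k) ⊎ (k ≤ i × j ≤ b) ⊎ (i , j) ≡ (a , b)
      chord-position {i} {j} ij∈cs (a≤i , j≤b) with j ≤? k | k ≤? i
      ... | yes j≤k | _       = inj₁ (a≤i , j≤k)
      ... | no _    | yes k≤i = inj₂ (inj₁ (k≤i , j≤b))
      ... | no j≰k  | no k≰i  with m≤n⇒m<n∨m≡n a≤i | m≤n⇒m<n∨m≡n j≤b
      ...   | inj₁ a<i  | _         = contradiction (inj₂ (a<i , ≰⇒> k≰i , ≰⇒> j≰k)) (edge-uncrossed left ij∈cs)
      ...   | inj₂ refl | inj₁ j<b  = contradiction (inj₁ (a<apex , ≰⇒> j≰k , j<b)) (edge-uncrossed right ij∈cs)
      ...   | inj₂ refl | inj₂ refl = inj₂ (inj₂ refl)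

      inside-split : ∀ {c} → c ∈ cs → inside a b c ≡ inside a k c + inside k b c + 𝟙 (c ≟ₚ (a , b))
      inside-split {i , j} ij∈cs =
        𝟙-partition (a ≤? i ×-dec j ≤? b) (a ≤? i ×-dec j ≤? k) (k ≤? i ×-dec j ≤? b) ((i , j) ≟ₚ (a , b))
          (chord-position ij∈cs)
          (λ { (inj₁ (a≤i , j≤k))         → a≤i , ≤-trans j≤k (<⇒≤ apex<b)
             ; (inj₂ (inj₁ (k≤i , j≤b))) → ≤-trans (<⇒≤ a<apex) k≤i , j≤b
             ; (inj₂ (inj₂ refl))         → ≤-refl , ≤-refl })
          (λ (_ , j≤k) (k≤i , _) → <⇒≱ (<-trans (n<1+n i) (proj₁ (All.lookup diagonals ij∈cs))) (≤-trans j≤k k≤i))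
          (λ { (_ , b≤k) refl → <⇒≱ apex<b b≤k })
          (λ { (k≤a , _) refl → <⇒≱ a<apex k≤a })

      regionSum-split : ∀ f →
        regionSum f a b ≡ regionSum f a k + regionSum f k b + sum (map (λ c → 𝟙 (c ≟ₚ (a , b)) * f (span c)) cs)
      regionSum-split f = begin
        sum (map (λ c → inside a b c * f (span c)) cs)
          ≡⟨ sum-map-cong (λ {c} c∈cs → trans (cong (_* f (span c)) (inside-split c∈cs)) (distrib c)) ⟩
        sum (map (λ c → inL c + inR c + isAB c) cs)
          ≡⟨ sum-map-+ (λ c → inL c + inR c) isAB cs ⟩
        sum (map (λ c → inL c + inR c) cs) + sum (map isAB cs)
          ≡⟨ cong (_+ sum (map isAB cs)) (sum-map-+ inL inR cs) ⟩
        sum (map inL cs) + sum (map inR cs) + sum (map isAB cs) ∎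
        where
        open ≡-Reasoning
        inL inR isAB : Pair → ℕ
        inL c  = inside a k c * f (span c)
        inR c  = inside k b c * f (span c)
        isAB c = 𝟙 (c ≟ₚ (a , b)) * f (span c)
        distrib : ∀ c → (inside a k c + inside k b c + 𝟙 (c ≟ₚ (a , b))) * f (span c) ≡ inL c + inR c + isAB c
        distrib c = trans (*-distribʳ-+ (f (span c)) (inside a k c + inside k b c) _)
                          (cong (_+ isAB c) (*-distribʳ-+ (f (span c)) (inside a k c) (inside k b c)))

      regionSum-chord : ∀ f → (a , b) ∈ cs → regionSum f a b ≡ regionSum f a k + regionSum f k b + f (b ∸ a)
      regionSum-chord f ab∈cs = trans (regionSum-split f)
        (cong (regionSum f a k + regionSum f k b +_) (sum-𝟙≡-∈ _≟ₚ_ (f ∘ span) distinct ab∈cs))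

      regionSum-non-chord : ∀ f → (a , b) ∉ cs → regionSum f a b ≡ regionSum f a k + regionSum f k b
      regionSum-non-chord f ab∉cs = trans (regionSum-split f)
        (trans (cong (regionSum f a k + regionSum f k b +_) (sum-𝟙≡-∉ _≟ₚ_ (f ∘ span) ab∉cs))
               (+-identityʳ (regionSum f a k + regionSum f k b)))

    regionSum-edge : ∀ f a → regionSum f a (suc a) ≡ 0
    regionSum-edge f a = sum-map-zero {xs = cs} λ { {i , j} ij∈cs → cong (_* f (j ∸ i))
      (𝟙-no (λ (a≤i , j≤1+a) → <⇒≱ (≤-pred (≤-trans (proj₁ (All.lookup diagonals ij∈cs)) j≤1+a)) a≤i)
            (a ≤? i ×-dec j ≤? suc a)) }

    regionSum-whole : ∀ f → sum (map (f ∘ span) cs) ≡ regionSum f 0 (suc N)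
    regionSum-whole f = sum-map-cong {xs = cs} λ { {i , j} ij∈cs → sym (trans
      (cong (_* f (j ∸ i))
            (𝟙-yes (z≤n , ≤-pred (proj₁ (proj₂ (All.lookup diagonals ij∈cs)))) (0 ≤? i ×-dec j ≤? suc N)))
      (+-identityʳ (f (j ∸ i)))) }

    region-≼-fan : ∀ {a b} → Acc _<_ (b ∸ a) → Edge a b →
      (regionSum len a b , regionSum ear a b) ≼ (fanSum (b ∸ a) , minEars (b ∸ a))
    region-≼-fan {a} _ (inj₁ refl) = ≼-reflexive (begin
      (regionSum len a (suc a) , regionSum ear a (suc a)) ≡⟨ cong₂ _,_ (regionSum-edge len a) (regionSum-edge ear a) ⟩
      (fanSum 1 , minEars 1)                              ≡⟨ cong (λ s → fanSum s , minEars s) (m+n∸n≡m 1 a) ⟨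
      (fanSum (suc a ∸ a) , minEars (suc a ∸ a))          ∎)
      where open ≡-Reasoning
    region-≼-fan {a} {b} (acc smaller) (inj₂ ab∈cs) = begin
      (regionSum len a b , regionSum ear a b)
        ≡⟨ cong₂ _,_ (regionSum-chord t len ab∈cs) (regionSum-chord t ear ab∈cs) ⟩
      (regionSum len a k + regionSum len k b + len (b ∸ a) , regionSum ear a k + regionSum ear k b + ear (b ∸ a))
        ≲⟨ ≼-+ (≼-+ (region-≼-fan (smaller (∸-monoˡ-< apex<b (<⇒≤ a<apex))) left)
                    (region-≼-fan (smaller (∸-monoʳ-< a<apex (<⇒≤ apex<b))) right))
               (≼-reflexive refl) ⟩
      (fanSum (k ∸ a) + fanSum (b ∸ k) + len (b ∸ a) , minEars (k ∸ a) + minEars (b ∸ k) + ear (b ∸ a))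
        ≲⟨ subst (λ s → (fanSum (k ∸ a) + fanSum (b ∸ k) + len s , minEars (k ∸ a) + minEars (b ∸ k) + ear s)
                          ≼ (fanSum s , minEars s))
                 spans (fan-glue (m<n⇒0<n∸m a<apex) (m<n⇒0<n∸m apex<b) (subst (_≤ N) (sym spans) (span≤N diagonal))) ⟩
      (fanSum (b ∸ a) , minEars (b ∸ a)) ∎
      where
      open ≼-Reasoning
      diagonal : IsDiag n (a , b)
      diagonal = All.lookup diagonals ab∈cs
      t : Triangle a b
      t = triangle (proj₁ diagonal) (proj₁ (proj₂ diagonal)) (edge-uncrossed (inj₂ ab∈cs))
      open Triangle t renaming (apex to k)
      spans : (k ∸ a) + (b ∸ k) ≡ b ∸ a
      spans = ∸-split (<⇒≤ a<apex) (<⇒≤ apex<b)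

    whole-uncrossed : Uncrossed 0 (suc N)
    whole-uncrossed {p , q} pq∈cs (inj₂ (_ , _ , 1+N<q)) =
      <⇒≱ 1+N<q (≤-pred (proj₁ (proj₂ (All.lookup diagonals pq∈cs))))

    whole-not-chord : (0 , suc N) ∉ cs
    whole-not-chord 0-1+N∈cs = proj₂ (proj₂ (All.lookup diagonals 0-1+N∈cs)) (refl , refl)

    TCL-numEars-≼-fan : (TCL n cs , numEars n cs) ≼ (fanSum N , 2)
    TCL-numEars-≼-fan = begin
      (TCL n cs , numEars n cs)
        ≡⟨ cong₂ _,_ (regionSum-whole len)
                     (trans (length-filter≡sum-𝟙 (λ c → chordLength n c ≟ 2) cs) (regionSum-whole ear)) ⟩
      (regionSum len 0 (suc N) , regionSum ear 0 (suc N))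
        ≡⟨ cong₂ _,_ (regionSum-non-chord t len whole-not-chord) (regionSum-non-chord t ear whole-not-chord) ⟩
      (regionSum len 0 k + regionSum len k (suc N) , regionSum ear 0 k + regionSum ear k (suc N))
        ≲⟨ ≼-+ (region-≼-fan (<-wellFounded _) left) (region-≼-fan (<-wellFounded _) right) ⟩
      (fanSum k + fanSum (suc N ∸ k) , minEars k + minEars (suc N ∸ k))
        ≡⟨ fan-complement (m<n⇒0<n∸m a<apex) (m<n⇒0<n∸m apex<b) (m+[n∸m]≡n (<⇒≤ apex<b)) ⟩
      (fanSum N , 2) ∎
      where
      open ≼-Reasoning
      t : Triangle 0 (suc N)
      t = triangle (s≤s (s≤s z≤n)) ≤-refl whole-uncrossed
      open Triangle t renaming (apex to k)

  TCL-fan : ∀ k → TCL n (fan k) ≡ fanSum k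
  TCL-fan 0             = refl
  TCL-fan 1             = refl
  TCL-fan (suc (suc k)) =
    trans (+-comm (len (2 + k)) (TCL n (fan (suc k)))) (cong (_+ len (2 + k)) (TCL-fan (suc k)))

  fan-triangulation : Triangulation n (fan N)
  fan-triangulation = record
    { diagonals = All.tabulate fan-diagonal
    ; distinct  = fan-unique N
    ; nonCross  = fan-non-crossing
    ; maximal   = fan-maximal
    }
    where
    fan-diagonal : ∀ {c} → c ∈ fan N → IsDiag n c
    fan-diagonal {i , l} c∈fan with ∈-fan⁻ c∈fan
    ... | refl , 2≤l , l≤N =
      2≤l , s≤s (m≤n⇒m≤1+n l≤N) , λ (_ , 1+l≡n) → 1+n≰n (≤-trans (≤-reflexive (sym (suc-injective 1+l≡n))) l≤N)
    fan-non-crossing : ∀ {c d} → c ∈ fan N → d ∈ fan N → ¬ Cross c d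
    fan-non-crossing {_ , _} {_ , _} c∈fan d∈fan cross with ∈-fan⁻ c∈fan | ∈-fan⁻ d∈fan
    fan-non-crossing _ _ (inj₁ (() , _)) | refl , _ | refl , _
    fan-non-crossing _ _ (inj₂ (() , _)) | refl , _ | refl , _
    fan-maximal : ∀ d → IsDiag n d → d ∉ fan N → ∃[ c ] c ∈ fan N × Cross c d
    fan-maximal (0 , j) diag@(2≤j , _ , _) d∉fan = contradiction (∈-fan⁺ 2≤j (span≤N diag)) d∉fan
    fan-maximal (suc i , j) (2+i<j , j<n , _) _ =
      (0 , 2 + i) , ∈-fan⁺ (s≤s (s≤s z≤n)) (≤-pred (<-≤-trans 2+i<j (≤-pred j<n))) , inj₁ (s≤s z≤n , ≤-refl , 2+i<j)

proposition3 : (n : ℕ) → 5 ≤ n → (cs : List Pair) → Triangulation n cs →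
    ((∀ ds → Triangulation n ds → TCL n ds ≤ TCL n cs) ⇔ (numEars n cs ≡ 2))
proposition3 _ (s≤s (s≤s (s≤s (s≤s (s≤s {n = m} z≤n))))) cs T = mk⇔ maximal⇒two-ears two-ears⇒maximal
  where
  open Polygon m
  open Triangulated using (TCL-numEars-≼-fan)

  maximal⇒two-ears : (∀ ds → Triangulation n ds → TCL n ds ≤ TCL n cs) → numEars n cs ≡ 2
  maximal⇒two-ears is-maximal with TCL-numEars-≼-fan T
  ... | inj₁ (_ , two-ears)   = two-ears
  ... | inj₂ (TCL<fanSum , _) =
    contradiction (subst (_≤ TCL n cs) (TCL-fan N) (is-maximal (fan N) fan-triangulation)) (<⇒≱ TCL<fanSum)

  two-ears⇒maximal : numEars n cs ≡ 2 → ∀ ds → Triangulation n ds → TCL n ds ≤ TCL n cs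
  two-ears⇒maximal two-ears ds T′ with TCL-numEars-≼-fan T
  ... | inj₁ (TCL≡fanSum , _) = subst (TCL n ds ≤_) (sym TCL≡fanSum) (proj₁ (≼⇒≤ (TCL-numEars-≼-fan T′)))
  ... | inj₂ (_ , 2<ears)     = contradiction two-ears (>⇒≢ 2<ears)
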